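{- Let $\mathbb{C}=(\mathcal{C},\preceq)$ be a well-formed constraint system, let $\mathfrak{c}$ be a $\preceq$-minimum constraint of $\mathbb{C}$ (which is simple), and let $(\theta,\sigma)$ be a solution to $\mathfrak{c}$. Then the restriction $\mathbb{C}\uparrow(\mathfrak{c},\theta,\sigma)$ is a well-formed constraint system.
   Context: Labels are label variables or the constant $\epsilon$; there is also a supply of free variables $\mathbf{x},\mathbf{y},\dots$; $\mathbf{u},\mathbf{v},\mathbf{w}$ denote labels or free variables. A relational atom is $(\mathbf{u},\mathbf{v}\triangleright\mathbf{w})$. A constraint is either $\mathcal{G}\vdash^?_R(\mathbf{u}=\mathbf{v})$ or $\mathcal{G}\vdash^?_R(\mathbf{u},\mathbf{v}\triangleright\mathbf{w})$ with $\mathcal{G}$ a set of relational atoms (its left-hand side $\mathcal{G}(\mathfrak{c})$); $fv(\cdot)$ denotes the set of free variables. A constraint system is a pair $(\mathcal{C},\preceq)$ of a set of constraints and a well-founded partial order on $\mathcal{C}$ with monotonicity: $\mathfrak{c}_1\preceq\mathfrak{c}_2$ implies $\mathcal{G}(\mathfrak{c}_1)\subseteq\mathcal{G}(\mathfrak{c}_2)$. It is well-formed if for every free variable $\mathbf{x}$ in $\mathcal{C}$ there is a unique $\preceq$-minimum constraint $\mathfrak{c}(\mathbf{x})=\mathcal{G}_x\vdash^?_R(\mathbf{u},\mathbf{v}\triangleright\mathbf{w})$ with $\mathbf{x}$ occurring in $(\mathbf{u},\mathbf{v}\triangleright\mathbf{w})$ but not in $\mathcal{G}_x$, and $\mathbf{x}$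 occurring in no $\mathfrak{c}'\preceq\mathfrak{c}(\mathbf{x})$, $\mathfrak{c}'\ne\mathfrak{c}(\mathbf{x})$. Structural rule instances on a set $\mathcal{G}$ of relational atoms (principal atoms must lie in $\mathcal{G}$): $E$: principal $(x,y\triangleright z)$, adds $(y,x\triangleright z)$; $U$: adds $(x,\epsilon\triangleright x)$; $A$: principal $(x,y\triangleright z),(u,v\triangleright x)$, adds $(u,w\triangleright z),(y,v\triangleright w)$, $w$ a fresh label; $A_C$: principal $(x,y\triangleright x)$, adds $(x,w\triangleright x),(y,y\triangleright w)$, $w$ fresh (identity substitution for these); $Eq_1$: principal $(\epsilon,w\triangleright w')$, $w\neq\epsilon$, substitution $[w'/w]$, adds $(\epsilon,w'\triangleright w')$; $Eq_2$: principal $(\epsilon,w'\triangleright w)$, $w\ne\epsilon$, substitution $[w'/w]$, adds $(\epsilon,w'\triangleright w')$. $\mathcal{S}(\mathcal{G},[\,])=\mathcal{G}$, $\mathcal{S}(\mathcal{G},[r;\sigma'])=\mathcal{S}(\mathcal{G}\theta_r\cup\{\text{atoms added by }r\},\sigma')$ when $r$'s principal atoms lie in $\mathcal{G}$, undefined otherwise. $\mathcal{G}\vdash_E(u=v)$ iff some sequence $\sigma$ of $Eq_1,Eq_2$ instances has $\mathcal{S}(\mathcal{G},\sigma)$ defined and $u\theta=v\theta$ for $\theta$ the composite of its substitutions. For a sequence $\sigma$ of $E,U,A,A_C$ instances: $\sigma$ derives $\mathcal{G}\vdash_R(w_1=w_2)$ iff $\mathcal{S}(\mathcal{G},\sigma)\vdash_E(w_1=w_2)$;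 $\sigma$ derives $\mathcal{G}\vdash_R(w_1,w_2\triangleright w_3)$ iff some $(w_1',w_2'\triangleright w_3')\in\mathcal{S}(\mathcal{G},\sigma)$ has $\mathcal{S}(\mathcal{G},\sigma)\vdash_E(w_i=w_i')$, $i=1,2,3$. A free-variable substitution maps finitely many free variables to free variables or labels. A constraint is simple if its left-hand side has no free variables. A solution to a simple constraint $\mathfrak{c}$ is a pair $(\theta,\sigma)$ of a free-variable substitution and a sequence $\sigma$ of $E,U,A,A_C$ instances such that $\sigma$ derives $\mathcal{G}\vdash_R(\mathbf{u}\theta=\mathbf{v}\theta)$ if $\mathfrak{c}$ is $\mathcal{G}\vdash^?_R(\mathbf{u}=\mathbf{v})$, resp. $\mathcal{G}\vdash_R(\mathbf{u}\theta,\mathbf{v}\theta\triangleright\mathbf{w}\theta)$ if $\mathfrak{c}$ is $\mathcal{G}\vdash^?_R(\mathbf{u},\mathbf{v}\triangleright\mathbf{w})$. Restriction: for $\mathbb{C}=(\mathcal{C},\preceq)$ well-formed, $\mathfrak{c}$ minimum with solution $(\theta,\sigma)$, put $\mathcal{G}'=\mathcal{S}(\mathcal{G}(\mathfrak{c}),\sigma)$ and define $f(\mathfrak{c}')=(\mathcal{G}'\cup\mathcal{G}\theta\vdash^?_R C\theta)$ if $\mathfrak{c}'=(\mathcal{G}\vdash^?_R C)\in\mathcal{C}\setminus\{\mathfrak{c}\}$ and $\mathfrak{c}\preceq\mathfrak{c}'$, and $f(\mathfrak{c}')=\mathfrak{c}'$ otherwise. Then $\mathbb{C}\uparrow(\mathfrak{c},\theta,\sigma)=(\mathcal{C}',\preceq')$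 with $\mathcal{C}'=\{f(\mathfrak{c}')\mid\mathfrak{c}'\in\mathcal{C}\setminus\{\mathfrak{c}\}\}$ and $f(\mathfrak{c}_1)\preceq'f(\mathfrak{c}_2)$ iff $\mathfrak{c}_1\preceq\mathfrak{c}_2$. -}

module Defs where

open import Data.Nat using (ℕ)
open import Data.Nat.Properties using () renaming (_≟_ to _≟ℕ_)
open import Data.Product using (Σ; ∃; _×_; _,_)
open import Data.Sum using (_⊎_)
open import Data.Unit using (⊤)
open import Data.Empty using (⊥)
open import Data.List using (List; []; _∷_)
open import Data.List.Membership.Propositional using (_∈_)
open import Relation.Nullary using (¬_; Dec; yes; no)
open import Relation.Binary.PropositionalEquality using (_≡_; _≢_; refl; cong)
open import Relation.Binary.Structures using (IsPartialOrder)
open import Induction.WellFounded using (WellFounded)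
open import Data.Refinement using (Refinement-syntax; value)

data Label : Set where
  lv : ℕ → Label
  ε  : Label

data Term : Set where
  lab : Label → Term
  fv  : ℕ → Term

record Atom : Set where
  constructor ⟨_,_▷_⟩
  field
    a₁ a₂ a₃ : Term
open Atom public

AtomSet : Set₁
AtomSet = Atom → Set

_⊆A_ : AtomSet → AtomSet → Set
G ⊆A H = ∀ a → G a → H a

_∪A_ : AtomSet → AtomSet → AtomSet
(G ∪A H) a = G a ⊎ H a

fromList : List Atom → AtomSet
fromList xs a = a ∈ xs

data Constraint : Set₁ where
  _⊢?eq_,_ : AtomSet → Term → Term → Constraint
  _⊢?rel_  : AtomSet → Atom → Constraint

lhs : Constraint → AtomSet
lhs (G ⊢?eq _ , _) = G
lhs (G ⊢?rel _)    = G

OccT : ℕ → Term → Set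
OccT x t = t ≡ fv x

OccA : ℕ → Atom → Set
OccA x ⟨ u , v ▷ w ⟩ = OccT x u ⊎ OccT x v ⊎ OccT x w

OccG : ℕ → AtomSet → Set
OccG x G = ∃ λ a → G a × OccA x a

OccRHS : ℕ → Constraint → Set
OccRHS x (_ ⊢?eq u , v) = OccT x u ⊎ OccT x v
OccRHS x (_ ⊢?rel a)    = OccA x a

OccC : ℕ → Constraint → Set
OccC x c = OccG x (lhs c) ⊎ OccRHS x c

Simple : Constraint → Set
Simple c = ∀ x → ¬ OccG x (lhs c)

IntroShape : ℕ → Constraint → Set
IntroShape x (G ⊢?rel a)    = OccA x a × ¬ OccG x G
IntroShape x (_ ⊢?eq _ , _) = ⊥

record CSData : Set₁ where
  field
    Idx : Set
    con : Idx → Constraint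
    _≼_ : Idx → Idx → Set
open CSData public

module _ (C : CSData) where
  private
    _≼'_ = _≼_ C

  _≺_ : Idx C → Idx C → Set
  i ≺ j = (i ≼' j) × (i ≢ j)

  record IsConstraintSystem : Set₁ where
    field
      isPartialOrder : IsPartialOrder _≡_ _≼'_
      wellFounded    : WellFounded _≺_
      monotone       : ∀ {i j} → i ≼' j → lhs (con C i) ⊆A lhs (con C j)

  OccCS : ℕ → Set
  OccCS x = ∃ λ i → OccC x (con C i)

  IsIntro : ℕ → Idx C → Set
  IsIntro x i = IntroShape x (con C i)
              × (∀ j → j ≼' i → j ≢ i → ¬ OccC x (con C j))

  WellFormed : Set
  WellFormed = ∀ x → OccCS x → Σ (Idx C) λ i → IsIntro x i × (∀ j → IsIntro x j → j ≡ i)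

  IsMinimum : Idx C → Set
  IsMinimum i = ∀ j → i ≼' j

_≟L_ : (a b : Label) → Dec (a ≡ b)
lv m ≟L lv n with m ≟ℕ n
... | yes refl = yes refl
... | no m≢n = no λ { refl → m≢n refl }
lv _ ≟L ε = no λ ()
ε ≟L lv _ = no λ ()
ε ≟L ε = yes refl

[_/_] : Label → Label → Label → Label
[ w' / w ] l with l ≟L w
... | yes _ = w'
... | no  _ = l

substLT : (Label → Label) → Term → Term
substLT s (lab l) = lab (s l)
substLT s (fv x)  = fv x

substLA : (Label → Label) → Atom → Atom
substLA s ⟨ u , v ▷ w ⟩ = ⟨ substLT s u , substLT s v ▷ substLT s w ⟩

substLG : (Label → Label) → AtomSet → AtomSet
substLG s G a = ∃ λ b → G b × substLA s b ≡ a

at : Label → Label → Label → Atom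
at x y z = ⟨ lab x , lab y ▷ lab z ⟩

data Rule : Set where
  E   : (x y z : Label) → Rule
  U   : (x : Label) → Rule
  A   : (x y z u v w : Label) → Rule
  AC  : (x y w : Label) → Rule
  Eq₁ : (w w' : Label) → Rule
  Eq₂ : (w w' : Label) → Rule

principal : Rule → List Atom
principal (E x y z)       = at x y z ∷ []
principal (U x)           = []
principal (A x y z u v w) = at x y z ∷ at u v x ∷ []
principal (AC x y w)      = at x y x ∷ []
principal (Eq₁ w w')      = at ε w w' ∷ []
principal (Eq₂ w w')      = at ε w' w ∷ []

added : Rule → List Atom
added (E x y z)       = at y x z ∷ []
added (U x)           = at x ε x ∷ []
added (A x y z u v w) = at u w z ∷ at y v w ∷ []
added (AC x y w)      = at x w x ∷ at y y w ∷ []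
added (Eq₁ w w')      = at ε w' w' ∷ []
added (Eq₂ w w')      = at ε w' w' ∷ []

θR : Rule → Label → Label
θR (Eq₁ w w') = [ w' / w ]
θR (Eq₂ w w') = [ w' / w ]
θR _          = λ l → l

Fresh : Label → AtomSet → Set
Fresh w G = ∀ a → G a → ¬ (a₁ a ≡ lab w ⊎ a₂ a ≡ lab w ⊎ a₃ a ≡ lab w)

side : Rule → AtomSet → Set
side (A x y z u v w) G = Fresh w G
side (AC x y w)      G = Fresh w G
side (Eq₁ w w')      G = w ≢ ε
side (Eq₂ w w')      G = w ≢ ε
side _               G = ⊤

Applicable : AtomSet → Rule → Set
Applicable G r = (fromList (principal r) ⊆A G) × side r G

step : AtomSet → Rule → AtomSet
step G r = substLG (θR r) G ∪A fromList (added r)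

Defined : AtomSet → List Rule → Set
Defined G []      = ⊤
Defined G (r ∷ σ) = Applicable G r × Defined (step G r) σ

-- 𝒮(G,σ) (meaningful when Defined G σ)
𝒮 : AtomSet → List Rule → AtomSet
𝒮 G []      = G
𝒮 G (r ∷ σ) = 𝒮 (step G r) σ

θseq : List Rule → Label → Label
θseq []      l = l
θseq (r ∷ σ) l = θseq σ (θR r l)

IsEqRule : Rule → Set
IsEqRule (Eq₁ _ _) = ⊤
IsEqRule (Eq₂ _ _) = ⊤
IsEqRule _         = ⊥

IsStructRule : Rule → Set
IsStructRule (E _ _ _)       = ⊤
IsStructRule (U _)           = ⊤
IsStructRule (A _ _ _ _ _ _) = ⊤
IsStructRule (AC _ _ _)      = ⊤
IsStructRule _               = ⊥

AllL : (Rule → Set) → List Rule → Set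
AllL P []      = ⊤
AllL P (r ∷ σ) = P r × AllL P σ

_⊢E_≐_ : AtomSet → Term → Term → Set
G ⊢E u ≐ v = Σ (List Rule) λ σ → AllL IsEqRule σ × Defined G σ
             × substLT (θseq σ) u ≡ substLT (θseq σ) v

DerivesEq : List Rule → AtomSet → Term → Term → Set
DerivesEq σ G u v = 𝒮 G σ ⊢E u ≐ v

DerivesRel : List Rule → AtomSet → Atom → Set
DerivesRel σ G ⟨ u , v ▷ w ⟩ =
  ∃ λ b → 𝒮 G σ b × (𝒮 G σ ⊢E u ≐ a₁ b) × (𝒮 G σ ⊢E v ≐ a₂ b) × (𝒮 G σ ⊢E w ≐ a₃ b)

FVSubst : Set
FVSubst = ℕ → Term

substT : FVSubst → Term → Term
substT θ (lab l) = lab l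
substT θ (fv x)  = θ x

substA : FVSubst → Atom → Atom
substA θ ⟨ u , v ▷ w ⟩ = ⟨ substT θ u , substT θ v ▷ substT θ w ⟩

substG : FVSubst → AtomSet → AtomSet
substG θ G a = ∃ λ b → G b × substA θ b ≡ a

Solution : Constraint → FVSubst → List Rule → Set
Solution (G ⊢?eq u , v) θ σ =
  AllL IsStructRule σ × Defined G σ × DerivesEq σ G (substT θ u) (substT θ v)
Solution (G ⊢?rel a) θ σ =
  AllL IsStructRule σ × Defined G σ × DerivesRel σ G (substA θ a)

-- restriction ℂ ↑ (c , θ , σ)   (c = con i₀, assumed ≼-minimum, so every
-- other constraint c' satisfies c ≼ c' and is transformed by f)

fC : AtomSet → FVSubst → Constraint → Constraint
fC G' θ (G ⊢?eq u , v) = (G' ∪A substG θ G) ⊢?eq substT θ u , substT θ v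
fC G' θ (G ⊢?rel a)    = (G' ∪A substG θ G) ⊢?rel substA θ a

restrict : (C : CSData) → Idx C → FVSubst → List Rule → CSData
restrict C i₀ θ σ = record
  { Idx = [ i ∈ Idx C ∣ i ≢ i₀ ]
  ; con = λ i → fC (𝒮 (lhs (con C i₀)) σ) θ (con C (value i))
  ; _≼_ = λ i j → _≼_ C (value i) (value j)
  }

-- A constraint of the restriction is f(c') = 𝒢' ∪ 𝒢θ ⊢? Cθ, where 𝒢' = 𝒮(𝒢(c),σ) is
-- ground: the minimum c is simple and structural rules introduce no free variables.
-- Every free variable y of c is introduced by c, so it lies in the right-hand side
-- of c; as (θ,σ) solves c, yθ is E-equal to a component of a ground atom, hence is
-- not a free variable. As θ is the identity off fv(c), θ sends a variable to a
-- variable only as the identity outside fv(c), so x ∈ fv(f(c')) iff x ∈ fv(c') and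
-- x ∉ fv(c). Hence the introducing
-- constraint c(x) of the restriction is f applied to the old one.
module Submission where

open import Defs
open import Data.Nat using (ℕ)
open import Data.List using (List; []; _∷_)
open import Data.List.Membership.Propositional using (_∈_)
open import Data.List.Relation.Unary.All using (All; []; _∷_; lookup)
open import Data.Product as Prod using (_×_; _,_; proj₁)
open import Data.Sum as Sum using (inj₁; inj₂)
open import Data.Empty using (⊥-elim)
open import Relation.Nullary using (¬_)
open import Relation.Binary.PropositionalEquality
  using (_≡_; _≢_; refl; sym; trans; cong; subst; subst₂; isEquivalence)
open import Relation.Binary.Structures using (IsPartialOrder)
open import Induction.WellFounded using (Acc; acc)
open import Data.Refinement using (value; _,_; value-injective)
open import Data.Irrelevant using ([_])

Ground : AtomSet → Set
Ground G = ∀ x → ¬ OccG x G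

fv-injective : ∀ {x y} → fv x ≡ fv y → x ≡ y
fv-injective refl = refl

substLT-fv : ∀ s t {x} → substLT s t ≡ fv x → t ≡ fv x
substLT-fv s (fv y) e = e

OccA-substLA : ∀ s a {x} → OccA x (substLA s a) → OccA x a
OccA-substLA s ⟨ u , v ▷ w ⟩ =
  Sum.map (substLT-fv s u) (Sum.map (substLT-fv s v) (substLT-fv s w))

substT-fv : ∀ θ t {x y} → t ≡ fv y → θ y ≡ fv x → substT θ t ≡ fv x
substT-fv θ t refl e = e

OccA-substA : ∀ θ a {x y} → OccA y a → θ y ≡ fv x → OccA x (substA θ a)
OccA-substA θ ⟨ u , v ▷ w ⟩ o e =
  Sum.map (λ p → substT-fv θ u p e)
          (Sum.map (λ p → substT-fv θ v p e) (λ p → substT-fv θ w p e)) o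

¬OccA-at : ∀ {x} p q r → ¬ OccA x (at p q r)
¬OccA-at p q r (inj₁ ())
¬OccA-at p q r (inj₂ (inj₁ ()))
¬OccA-at p q r (inj₂ (inj₂ ()))

added-ground : ∀ r {x a} → a ∈ added r → ¬ OccA x a
added-ground r = lookup (all-ground r)
  where
  all-ground : ∀ r {x} → All (λ a → ¬ OccA x a) (added r)
  all-ground (E x y z)       = ¬OccA-at y x z ∷ []
  all-ground (U x)           = ¬OccA-at x ε x ∷ []
  all-ground (A x y z u v w) = ¬OccA-at u w z ∷ ¬OccA-at y v w ∷ []
  all-ground (AC x y w)      = ¬OccA-at x w x ∷ ¬OccA-at y y w ∷ []
  all-ground (Eq₁ w w')      = ¬OccA-at ε w' w' ∷ []
  all-ground (Eq₂ w w')      = ¬OccA-at ε w' w' ∷ []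

step-ground : ∀ G r → Ground G → Ground (step G r)
step-ground G r G-ground x (a , inj₁ (b , b∈G , refl) , o) = G-ground x (b , b∈G , OccA-substLA (θR r) b o)
step-ground G r G-ground x (a , inj₂ a∈added , o)          = added-ground r a∈added o

𝒮-ground : ∀ G σ → Ground G → Ground (𝒮 G σ)
𝒮-ground G []      G-ground = G-ground
𝒮-ground G (r ∷ σ) G-ground = 𝒮-ground (step G r) σ (step-ground G r G-ground)

⊢E-fv : ∀ {G x} t → G ⊢E fv x ≐ t → t ≡ fv x
⊢E-fv t (σ , _ , _ , e) = substLT-fv (θseq σ) t (sym e)

derivesRel-OccA : ∀ σ G a {x} → DerivesRel σ G a → OccA x a → OccG x (𝒮 G σ)
derivesRel-OccA σ G ⟨ u , v ▷ w ⟩ (b , b∈ , u≐ , v≐ , w≐) (inj₁ refl)        = b , b∈ , inj₁ (⊢E-fv (a₁ b) u≐)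
derivesRel-OccA σ G ⟨ u , v ▷ w ⟩ (b , b∈ , u≐ , v≐ , w≐) (inj₂ (inj₁ refl)) = b , b∈ , inj₂ (inj₁ (⊢E-fv (a₂ b) v≐))
derivesRel-OccA σ G ⟨ u , v ▷ w ⟩ (b , b∈ , u≐ , v≐ , w≐) (inj₂ (inj₂ refl)) = b , b∈ , inj₂ (inj₂ (⊢E-fv (a₃ b) w≐))

solution-IntroShape-¬fv : ∀ c {θ σ x y} → Simple c → IntroShape y c → Solution c θ σ → θ y ≢ fv x
solution-IntroShape-¬fv (G ⊢?rel a) {θ} {σ} {x} simple (y∈a , _) (_ , _ , derives) θy≡x =
  𝒮-ground G σ simple x (derivesRel-OccA σ G (substA θ a) derives (OccA-substA θ a y∈a θy≡x))

IntroShape⇒¬OccG : ∀ c {x} → IntroShape x c → ¬ OccG x (lhs c)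
IntroShape⇒¬OccG (G ⊢?rel a) (_ , x∉G) = x∉G

IntroShape⇒OccC : ∀ c {x} → IntroShape x c → OccC x c
IntroShape⇒OccC (G ⊢?rel a) (x∈a , _) = inj₂ x∈a

-- fC G' θ is the map f of the restriction; Kept x will be x ∉ fv(c).

module Transform (G' : AtomSet) (G'-ground : Ground G') (θ : FVSubst) (Kept : ℕ → Set)
  (θ-fv : ∀ {y x} → θ y ≡ fv x → y ≡ x × Kept x)
  (θ-id : ∀ {x} → Kept x → θ x ≡ fv x) where

  substT-fv⁻ : ∀ t {x} → substT θ t ≡ fv x → t ≡ fv x × Kept x
  substT-fv⁻ (fv y) e with θ-fv e
  ... | refl , kept = refl , kept

  OccA-substA⁻ : ∀ a {x} → OccA x (substA θ a) → OccA x a × Kept x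
  OccA-substA⁻ ⟨ u , v ▷ w ⟩ (inj₁ e)        = Prod.map₁ inj₁ (substT-fv⁻ u e)
  OccA-substA⁻ ⟨ u , v ▷ w ⟩ (inj₂ (inj₁ e)) = Prod.map₁ (λ p → inj₂ (inj₁ p)) (substT-fv⁻ v e)
  OccA-substA⁻ ⟨ u , v ▷ w ⟩ (inj₂ (inj₂ e)) = Prod.map₁ (λ p → inj₂ (inj₂ p)) (substT-fv⁻ w e)

  OccA-substA⁺ : ∀ a {x} → Kept x → OccA x a → OccA x (substA θ a)
  OccA-substA⁺ a kept o = OccA-substA θ a o (θ-id kept)

  OccG-extend⁻ : ∀ G {x} → OccG x (G' ∪A substG θ G) → OccG x G × Kept x
  OccG-extend⁻ G (a , inj₁ a∈G' , o)              = ⊥-elim (G'-ground _ (a , a∈G' , o))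
  OccG-extend⁻ G (_ , inj₂ (b , b∈G , refl) , o) = Prod.map₁ (λ ob → b , b∈G , ob) (OccA-substA⁻ b o)

  OccG-extend⁺ : ∀ G {x} → Kept x → OccG x G → OccG x (G' ∪A substG θ G)
  OccG-extend⁺ G kept (b , b∈G , o) = substA θ b , inj₂ (b , b∈G , refl) , OccA-substA⁺ b kept o

  OccC-fC⁻ : ∀ c {x} → OccC x (fC G' θ c) → OccC x c × Kept x
  OccC-fC⁻ (G ⊢?eq u , v) (inj₁ o)        = Prod.map₁ inj₁ (OccG-extend⁻ G o)
  OccC-fC⁻ (G ⊢?rel a)    (inj₁ o)        = Prod.map₁ inj₁ (OccG-extend⁻ G o)
  OccC-fC⁻ (G ⊢?eq u , v) (inj₂ (inj₁ e)) = Prod.map₁ (λ p → inj₂ (inj₁ p)) (substT-fv⁻ u e)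
  OccC-fC⁻ (G ⊢?eq u , v) (inj₂ (inj₂ e)) = Prod.map₁ (λ p → inj₂ (inj₂ p)) (substT-fv⁻ v e)
  OccC-fC⁻ (G ⊢?rel a)    (inj₂ o)        = Prod.map₁ inj₂ (OccA-substA⁻ a o)

  OccC-fC⁺ : ∀ c {x} → Kept x → OccC x c → OccC x (fC G' θ c)
  OccC-fC⁺ (G ⊢?eq u , v) kept (inj₁ o)        = inj₁ (OccG-extend⁺ G kept o)
  OccC-fC⁺ (G ⊢?rel a)    kept (inj₁ o)        = inj₁ (OccG-extend⁺ G kept o)
  OccC-fC⁺ (G ⊢?eq u , v) kept (inj₂ (inj₁ e)) = inj₂ (inj₁ (substT-fv θ u e (θ-id kept)))
  OccC-fC⁺ (G ⊢?eq u , v) kept (inj₂ (inj₂ e)) = inj₂ (inj₂ (substT-fv θ v e (θ-id kept)))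
  OccC-fC⁺ (G ⊢?rel a)    kept (inj₂ o)        = inj₂ (OccA-substA⁺ a kept o)

  IntroShape-fC⁻ : ∀ c {x} → IntroShape x (fC G' θ c) → IntroShape x c
  IntroShape-fC⁻ (G ⊢?rel a) (o , x∉G) =
    let x∈a , kept = OccA-substA⁻ a o in x∈a , λ x∈G → x∉G (OccG-extend⁺ G kept x∈G)

  IntroShape-fC⁺ : ∀ c {x} → Kept x → IntroShape x c → IntroShape x (fC G' θ c)
  IntroShape-fC⁺ (G ⊢?rel a) kept (x∈a , x∉G) =
    OccA-substA⁺ a kept x∈a , λ o → x∉G (proj₁ (OccG-extend⁻ G o))

  lhs-fC : ∀ c → lhs (fC G' θ c) ≡ G' ∪A substG θ (lhs c)
  lhs-fC (G ⊢?eq u , v) = refl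
  lhs-fC (G ⊢?rel a)    = refl

  lhs-fC-mono : ∀ c d → lhs c ⊆A lhs d → lhs (fC G' θ c) ⊆A lhs (fC G' θ d)
  lhs-fC-mono c d c⊆d = subst₂ _⊆A_ (sym (lhs-fC c)) (sym (lhs-fC d)) extend-mono
    where
    extend-mono : (G' ∪A substG θ (lhs c)) ⊆A (G' ∪A substG θ (lhs d))
    extend-mono a (inj₁ a∈G')             = inj₁ a∈G'
    extend-mono a (inj₂ (b , b∈c , θb≡a)) = inj₂ (b , c⊆d b b∈c , θb≡a)

module Restriction (C : CSData) (isCS : IsConstraintSystem C) (wf : WellFormed C)
  (i₀ : Idx C) (minimum : IsMinimum C i₀) (θ : FVSubst) (σ : List Rule)
  (solution : Solution (con C i₀) θ σ) (θ-id : ∀ x → ¬ OccC x (con C i₀) → θ x ≡ fv x) where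

  open IsConstraintSystem isCS
  module ≼ = IsPartialOrder isPartialOrder

  c₀ : Constraint
  c₀ = con C i₀

  R : CSData
  R = restrict C i₀ θ σ

  -- Stated doubly negated because indices need not have decidable equality.
  minimum-introduces : ∀ {y} → OccC y c₀ → ¬ ¬ IntroShape y c₀
  minimum-introduces {y} o ¬shape with wf y (i₀ , o)
  ... | i , (shape , below) , _ =
    below i₀ (minimum i) (λ i₀≡i → ¬shape (subst (λ k → IntroShape y (con C k)) (sym i₀≡i) shape)) o

  c₀-simple : Simple c₀
  c₀-simple x o = minimum-introduces (inj₁ o) (λ shape → IntroShape⇒¬OccG c₀ shape o)

  θ-fv : ∀ {y x} → θ y ≡ fv x → y ≡ x × ¬ OccC x c₀
  θ-fv {y} {x} θy≡x = y≡x , subst (λ z → ¬ OccC z c₀) y≡x y∉c₀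
    where
    y∉c₀ : ¬ OccC y c₀
    y∉c₀ o = minimum-introduces o (λ shape → solution-IntroShape-¬fv c₀ c₀-simple shape solution θy≡x)
    y≡x : y ≡ x
    y≡x = fv-injective (trans (sym (θ-id y y∉c₀)) θy≡x)

  open Transform (𝒮 (lhs c₀) σ) (𝒮-ground (lhs c₀) σ c₀-simple) θ (λ x → ¬ OccC x c₀) θ-fv (θ-id _)

  acc-restrict : ∀ i → Acc (_≺_ C) (value i) → Acc (_≺_ R) i
  acc-restrict i (acc rs) =
    acc λ {j} (j≼i , j≢i) → acc-restrict j (rs (j≼i , λ e → j≢i (value-injective e)))

  isConstraintSystem : IsConstraintSystem R
  isConstraintSystem = record
    { isPartialOrder = record
      { isPreorder = record
        { isEquivalence = isEquivalence
        ; reflexive     = λ { refl → ≼.refl }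
        ; trans         = ≼.trans
        }
      ; antisym = λ i≼j j≼i → value-injective (≼.antisym i≼j j≼i)
      }
    ; wellFounded = λ i → acc-restrict i (wellFounded (value i))
    ; monotone    = λ {i} {j} i≼j → lhs-fC-mono (con C (value i)) (con C (value j)) (monotone i≼j)
    }

  OccC⇒≢i₀ : ∀ {x j} → ¬ OccC x c₀ → OccC x (con C j) → j ≢ i₀
  OccC⇒≢i₀ {x} x∉c₀ x∈j refl = x∉c₀ x∈j

  IsIntro-restrict⁺ : ∀ {x} → ¬ OccC x c₀ → (i : Idx R) → IsIntro C x (value i) → IsIntro R x i
  IsIntro-restrict⁺ x∉c₀ i (shape , below) =
      IntroShape-fC⁺ (con C (value i)) x∉c₀ shape
    , λ j j≼i j≢i x∈j →
        below (value j) j≼i (λ e → j≢i (value-injective e)) (proj₁ (OccC-fC⁻ (con C (value j)) x∈j))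

  IsIntro-restrict⁻ : ∀ {x} → ¬ OccC x c₀ → (i : Idx R) → IsIntro R x i → IsIntro C x (value i)
  IsIntro-restrict⁻ x∉c₀ i (shape , below) =
      IntroShape-fC⁻ (con C (value i)) shape
    , λ j j≼i j≢i x∈j →
        below (j , [ OccC⇒≢i₀ x∉c₀ x∈j ]) j≼i (λ e → j≢i (cong value e)) (OccC-fC⁺ (con C j) x∉c₀ x∈j)

  isWellFormed : WellFormed R
  isWellFormed x (i , x∈i) with OccC-fC⁻ (con C (value i)) x∈i
  ... | x∈i' , x∉c₀ with wf x (value i , x∈i')
  ... | j , intro@(shape , _) , unique =
      j'
    , IsIntro-restrict⁺ x∉c₀ j' intro
    , λ k intro-k → value-injective (unique (value k) (IsIntro-restrict⁻ x∉c₀ k intro-k))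
    where
    j' : Idx R
    j' = j , [ OccC⇒≢i₀ x∉c₀ (IntroShape⇒OccC (con C j) shape) ]

lemma8 : (C : CSData) → IsConstraintSystem C → WellFormed C
    → (i₀ : Idx C) → IsMinimum C i₀
    → (θ : FVSubst) (σ : List Rule) → Solution (con C i₀) θ σ
    → (∀ x → ¬ OccC x (con C i₀) → θ x ≡ fv x)
    → IsConstraintSystem (restrict C i₀ θ σ) × WellFormed (restrict C i₀ θ σ)
lemma8 C isCS wf i₀ minimum θ σ solution θ-id = isConstraintSystem , isWellFormed
  where open Restriction C isCS wf i₀ minimum θ σ solution θ-id
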